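{- Let $d=2l$ be even with $d\ge 4$ and let $n\ge d+1$. Let $\varphi:[n]\to[c]$ be a CF-coloring of $\mathsf{FC}_d(n)$ using $c$ colors. Then the palette graph $P_{M_{[n]},\varphi}$ contains no submultigraph with exactly $l$ edges and minimum degree at least $2$.
   Context: A conflict-free coloring (CF-coloring) of a hypergraph $(V,\mathcal{E})$ is a map $\varphi$ on $V$ such that every nonempty hyperedge $e$ contains a vertex $x$ with $\varphi(y)\ne\varphi(x)$ for all $y\in e\setminus\{x\}$. $\mathsf{FC}_d(n)$ is the $d$-uniform hypergraph on $[n]$ whose hyperedges are the vertex sets of facets of the cyclic polytope $\mathrm{conv}\{\gamma_d(1),\dots,\gamma_d(n)\}$, $\gamma_d(t)=(t,\dots,t^d)$, with $\gamma_d(i)$ identified with $i$; equivalently, a $d$-subset $S\subseteq[n]$ is a hyperedge iff for all $i,j\in[n]\setminus S$ the set $\{k\in S:i<k<j\}$ has even size. $M_{[n]}$ is the graph on $[n]$ with edge set $\{\{2i-1,2i\}: i \text{ integer}, 1\le i\le n/2\}$. For a simple graph $G=(V,E)$ and coloring $\varphi:V\to[c]$, the palette graph $P_{G,\varphi}$ is the multigraph on $[c]$ whose edges are in bijection with $E$, the edge $\{v_1,v_2\}\in E$ corresponding to an edge (possibly a loop) between $\varphi(v_1)$ and $\varphi(v_2)$. In a multigraph, a loop contributes $2$ to the degree of its vertex. -}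

module Defs where

open import Data.Nat using (ℕ; zero; suc; _+_; _*_; _≤_)
open import Data.Nat.Divisibility using (_∣_)
open import Data.Bool using (Bool; true; false; if_then_else_; _∧_)
open import Data.Fin using (Fin; zero; suc; _<?_; _≟_)
open import Data.Fin.Subset using (Subset; _∈_; _∉_; _∩_; ∣_∣; inside; outside)
open import Data.List using (List; []; _∷_; map; length; lookup)
open import Data.Vec using (Vec; []; _∷_; tabulate)
open import Data.Product using (_×_; _,_; proj₁; proj₂; ∃; Σ-syntax)
open import Relation.Binary.PropositionalEquality using (_≡_; _≢_)
open import Relation.Nullary.Decidable using (⌊_⌋)

-- Vertices [n] = {1,…,n} are represented by Fin n (vertex i ↦ i - 1).

between : {n : ℕ} → Fin n → Fin n → Subset n
between i j = tabulate λ k → ⌊ i <? k ⌋ ∧ ⌊ k <? j ⌋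

IsFCEdge : (d n : ℕ) → Subset n → Set
IsFCEdge d n S = (∣ S ∣ ≡ d) × (∀ (i j : Fin n) → i ∉ S → j ∉ S → 2 ∣ ∣ S ∩ between i j ∣)

Hypergraph : ℕ → Set₁
Hypergraph n = Subset n → Set

FC : (d n : ℕ) → Hypergraph n
FC d n = IsFCEdge d n

NonEmpty : {n : ℕ} → Subset n → Set
NonEmpty {n} e = ∃ λ (x : Fin n) → x ∈ e

IsCFColoring : {n c : ℕ} → Hypergraph n → (Fin n → Fin c) → Set
IsCFColoring {n} H φ =
  ∀ (e : Subset n) → H e → NonEmpty e →
    Σ[ x ∈ Fin n ] (x ∈ e × (∀ (y : Fin n) → y ∈ e → y ≢ x → φ y ≢ φ x))

EdgeList : ℕ → Set
EdgeList n = List (Fin n × Fin n)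

-- M_[n]: edges {2i-1, 2i} for 1 ≤ i ≤ n/2; in 0-indexed form {0,1},{2,3},…
matching : (n : ℕ) → EdgeList n
matching zero = []
matching (suc zero) = []
matching (suc (suc n)) =
  (zero , suc zero) ∷ map (λ p → (suc (suc (proj₁ p)) , suc (suc (proj₂ p)))) (matching n)

palette : {n c : ℕ} → EdgeList n → (Fin n → Fin c) → EdgeList c
palette G φ = map (λ p → (φ (proj₁ p) , φ (proj₂ p))) G

-- number of ends of edge (a , b) equal to v (a loop counts 2)
endCount : {c : ℕ} → Fin c × Fin c → Fin c → ℕ
endCount (a , b) v = (if ⌊ a ≟ v ⌋ then 1 else 0) + (if ⌊ b ≟ v ⌋ then 1 else 0)

degree : {c : ℕ} (es : EdgeList c) → Subset (length es) → Fin c → ℕ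
degree [] [] v = 0
degree (e ∷ es) (x ∷ F) v = (if x then endCount e v else 0) + degree es F v

IsSubMultigraph : {c : ℕ} (es : EdgeList c) → Subset c → Subset (length es) → Set
IsSubMultigraph es W F =
  ∀ i → i ∈ F → (proj₁ (lookup es i) ∈ W) × (proj₂ (lookup es i) ∈ W)

HasSubMultigraphMinDeg2 : {c : ℕ} (es : EdgeList c) (l : ℕ) → Set
HasSubMultigraphMinDeg2 {c} es l =
  Σ[ W ∈ Subset c ] Σ[ F ∈ Subset (length es) ]
    (IsSubMultigraph es W F × ∣ F ∣ ≡ l × (∀ v → v ∈ W → 2 ≤ degree es F v))

-- Suppose F is a set of l matching edges {2i-1, 2i} whose palette image has
-- minimum degree at least 2 on its vertex set. The endpoints of these edges
-- form a set S of 2l vertices made of disjoint consecutive pairs, so S meets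
-- every interval between two vertices outside S in an even number of
-- vertices (Gale's evenness condition) and is a hyperedge of FC_{2l}(n). The
-- degree of a colour v in the palette submultigraph is the number of vertices
-- of S coloured v. Hence every colour used on S occurs there at least twice,
-- and S has no vertex of unique colour.

module Submission where

open import Defs
open import Data.Bool using (if_then_else_; _∧_)
open import Data.Empty using (⊥-elim)
open import Data.Fin using (Fin; zero; suc; toℕ; _<?_; _≟_)
import Data.Fin as Fin
open import Data.Fin.Properties using (toℕ-injective)
open import Data.Fin.Subset
  using (Subset; _∈_; _∉_; _⊆_; _∩_; _∪_; ∣_∣; ⁅_⁆; ⊥; ⊤; inside; outside; Empty; Nonempty)
open import Data.Fin.Subset.Properties
  using (∣⊥∣≡0; ∣⁅x⁆∣≡1; ∉⊥; x∈⁅x⁆; x∈⁅y⁆⇒x≡y; x∈p∩q⁺; x∈p∩q⁻; x∈p∪q⁺; x∈p∪q⁻; q⊆p∪q;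
         p⊆q⇒∣p∣≤∣q∣; ∩-zeroˡ; ∩-identityʳ; ∩-distribʳ-∪)
open import Data.List using ([]; _∷_; map; length)
open import Data.List.Relation.Unary.All as All using (All; []; _∷_)
open import Data.List.Relation.Unary.All.Properties using (map⁺)
import Data.List.Relation.Binary.Sublist.Propositional as Sublist
open Sublist using ([]; _∷_; _∷ʳ_)
open import Data.List.Relation.Binary.Sublist.Propositional.Properties using (All-resp-⊆)
open import Data.Nat using (ℕ; zero; suc; _+_; _*_; _≤_; _<_; z≤n; s≤s)
open import Data.Nat.Properties
  using (≤-trans; ≤-reflexive; <-trans; ≤∧≢⇒<; m<1+n⇒m≤n; ≤⇒≯;
         +-suc; +-identityʳ; +-assoc; *-distribˡ-+)
open import Data.Nat.Divisibility using (_∣_; m∣m*n; ∣m∣n⇒∣m+n)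
open import Data.Product using (_×_; _,_; proj₁; proj₂)
open import Data.Sum using ([_,_]′; inj₁; inj₂) renaming (map₂ to ⊎-map₂)
open import Data.Unit using (tt) renaming (⊤ to Unit)
open import Data.Vec using ([]; _∷_; lookup; tabulate; here; there)
open import Data.Vec.Properties using (lookup∘tabulate; []=⇒lookup)
open import Function using (_∘_; id; _⇔_; mk⇔)
open import Relation.Nullary using (¬_; yes; no; contradiction)
open import Relation.Nullary.Decidable using (Dec; ⌊_⌋; isYes≗does; does-⇔)
open import Relation.Binary.PropositionalEquality
  using (_≡_; _≢_; refl; sym; trans; cong; cong₂; subst; module ≡-Reasoning)

private
  variable
    n c : ℕ
    p : Subset n

∣⊥∩p∣≡0 : (p : Subset n) → ∣ ⊥ ∩ p ∣ ≡ 0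
∣⊥∩p∣≡0 {n} p = trans (cong ∣_∣ (∩-zeroˡ p)) (∣⊥∣≡0 n)

∣⁅x⁆∩p∣≡lookup : (x : Fin n) (p : Subset n) → ∣ ⁅ x ⁆ ∩ p ∣ ≡ (if lookup p x then 1 else 0)
∣⁅x⁆∩p∣≡lookup zero    (inside  ∷ p) = cong suc (∣⊥∩p∣≡0 p)
∣⁅x⁆∩p∣≡lookup zero    (outside ∷ p) = ∣⊥∩p∣≡0 p
∣⁅x⁆∩p∣≡lookup (suc x) (_       ∷ p) = ∣⁅x⁆∩p∣≡lookup x p

∣⁅x⁆∩⊤∣≡1 : (x : Fin n) → ∣ ⁅ x ⁆ ∩ ⊤ ∣ ≡ 1
∣⁅x⁆∩⊤∣≡1 x = trans (cong ∣_∣ (∩-identityʳ ⁅ x ⁆)) (∣⁅x⁆∣≡1 x)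

Empty-drop-∷ : ∀ {x} → Empty (x ∷ p) → Empty p
Empty-drop-∷ e (i , i∈p) = e (suc i , there i∈p)

∣p∪q∣≡∣p∣+∣q∣ : (p q : Subset n) → Empty (p ∩ q) → ∣ p ∪ q ∣ ≡ ∣ p ∣ + ∣ q ∣
∣p∪q∣≡∣p∣+∣q∣ []            []            _ = refl
∣p∪q∣≡∣p∣+∣q∣ (inside  ∷ p) (inside  ∷ q) d = ⊥-elim (d (zero , here))
∣p∪q∣≡∣p∣+∣q∣ (inside  ∷ p) (outside ∷ q) d = cong suc (∣p∪q∣≡∣p∣+∣q∣ p q (Empty-drop-∷ d))
∣p∪q∣≡∣p∣+∣q∣ (outside ∷ p) (inside  ∷ q) d =
  trans (cong suc (∣p∪q∣≡∣p∣+∣q∣ p q (Empty-drop-∷ d))) (sym (+-suc ∣ p ∣ ∣ q ∣))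
∣p∪q∣≡∣p∣+∣q∣ (outside ∷ p) (outside ∷ q) d = ∣p∪q∣≡∣p∣+∣q∣ p q (Empty-drop-∷ d)

∣⁅x⁆∪q∩p∣≡∣⁅x⁆∩p∣+∣q∩p∣ : (x : Fin n) (q p : Subset n) → x ∉ q →
                          ∣ (⁅ x ⁆ ∪ q) ∩ p ∣ ≡ ∣ ⁅ x ⁆ ∩ p ∣ + ∣ q ∩ p ∣
∣⁅x⁆∪q∩p∣≡∣⁅x⁆∩p∣+∣q∩p∣ x q p x∉q =
  trans (cong ∣_∣ (∩-distribʳ-∪ p ⁅ x ⁆ q)) (∣p∪q∣≡∣p∣+∣q∣ _ _ disjoint)
  where
  disjoint : Empty ((⁅ x ⁆ ∩ p) ∩ (q ∩ p))
  disjoint (y , y∈) with x∈p∩q⁻ _ _ y∈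
  ... | y∈⁅x⁆∩p , y∈q∩p with x∈⁅y⁆⇒x≡y x (proj₁ (x∈p∩q⁻ _ _ y∈⁅x⁆∩p))
  ... | refl = x∉q (proj₁ (x∈p∩q⁻ _ _ y∈q∩p))

endpoints : EdgeList n → Subset n
endpoints []             = ⊥
endpoints ((a , b) ∷ es) = ⁅ a ⁆ ∪ (⁅ b ⁆ ∪ endpoints es)

IsMatching : EdgeList n → Set
IsMatching []             = Unit
IsMatching ((a , b) ∷ es) = a ≢ b × a ∉ endpoints es × b ∉ endpoints es × IsMatching es

incidences : Subset n → EdgeList n → ℕ
incidences p []             = 0
incidences p ((a , b) ∷ es) = ∣ ⁅ a ⁆ ∩ p ∣ + (∣ ⁅ b ⁆ ∩ p ∣ + incidences p es)

∣endpoints∩p∣≡incidences : (es : EdgeList n) → IsMatching es → (p : Subset n) →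
                           ∣ endpoints es ∩ p ∣ ≡ incidences p es
∣endpoints∩p∣≡incidences []             _                      p = ∣⊥∩p∣≡0 p
∣endpoints∩p∣≡incidences ((a , b) ∷ es) (a≢b , a∉es , b∉es , m) p = begin
  ∣ (⁅ a ⁆ ∪ (⁅ b ⁆ ∪ endpoints es)) ∩ p ∣
    ≡⟨ ∣⁅x⁆∪q∩p∣≡∣⁅x⁆∩p∣+∣q∩p∣ a _ p a∉b∪es ⟩
  ∣ ⁅ a ⁆ ∩ p ∣ + ∣ (⁅ b ⁆ ∪ endpoints es) ∩ p ∣
    ≡⟨ cong (∣ ⁅ a ⁆ ∩ p ∣ +_) (∣⁅x⁆∪q∩p∣≡∣⁅x⁆∩p∣+∣q∩p∣ b _ p b∉es) ⟩
  ∣ ⁅ a ⁆ ∩ p ∣ + (∣ ⁅ b ⁆ ∩ p ∣ + ∣ endpoints es ∩ p ∣)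
    ≡⟨ cong (λ k → ∣ ⁅ a ⁆ ∩ p ∣ + (∣ ⁅ b ⁆ ∩ p ∣ + k)) (∣endpoints∩p∣≡incidences es m p) ⟩
  incidences p ((a , b) ∷ es) ∎
  where
  open ≡-Reasoning
  a∉b∪es : a ∉ ⁅ b ⁆ ∪ endpoints es
  a∉b∪es = [ a≢b ∘ x∈⁅y⁆⇒x≡y b , a∉es ]′ ∘ x∈p∪q⁻ ⁅ b ⁆ (endpoints es)

incidences-⊤ : (es : EdgeList n) → incidences ⊤ es ≡ 2 * length es
incidences-⊤ []             = refl
incidences-⊤ ((a , b) ∷ es) = begin
  ∣ ⁅ a ⁆ ∩ ⊤ ∣ + (∣ ⁅ b ⁆ ∩ ⊤ ∣ + incidences ⊤ es)
    ≡⟨ cong₂ (λ s t → s + (t + incidences ⊤ es)) (∣⁅x⁆∩⊤∣≡1 a) (∣⁅x⁆∩⊤∣≡1 b) ⟩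
  2 + incidences ⊤ es      ≡⟨ cong (2 +_) (incidences-⊤ es) ⟩
  2 * 1 + 2 * length es    ≡⟨ *-distribˡ-+ 2 1 (length es) ⟨
  2 * length ((a , b) ∷ es) ∎
  where open ≡-Reasoning

∣endpoints∣≡2*length : (es : EdgeList n) → IsMatching es → ∣ endpoints es ∣ ≡ 2 * length es
∣endpoints∣≡2*length es m = begin
  ∣ endpoints es ∣      ≡⟨ cong ∣_∣ (∩-identityʳ (endpoints es)) ⟨
  ∣ endpoints es ∩ ⊤ ∣  ≡⟨ ∣endpoints∩p∣≡incidences es m ⊤ ⟩
  incidences ⊤ es       ≡⟨ incidences-⊤ es ⟩
  2 * length es         ∎
  where open ≡-Reasoning

Balanced : Subset n → Fin n × Fin n → Set
Balanced p (a , b) = lookup p a ≡ lookup p b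

incidences-even : (p : Subset n) (es : EdgeList n) → All (Balanced p) es → 2 ∣ incidences p es
incidences-even p []             []          = m∣m*n 0
incidences-even p ((a , b) ∷ es) (a~b ∷ bal) =
  subst (λ k → 2 ∣ k + (∣ ⁅ b ⁆ ∩ p ∣ + incidences p es)) (sym ∣⁅a⁆∩p∣≡∣⁅b⁆∩p∣)
        (subst (2 ∣_) (+-assoc k k _) (∣m∣n⇒∣m+n 2∣k+k (incidences-even p es bal)))
  where
  k = ∣ ⁅ b ⁆ ∩ p ∣
  ∣⁅a⁆∩p∣≡∣⁅b⁆∩p∣ : ∣ ⁅ a ⁆ ∩ p ∣ ≡ k
  ∣⁅a⁆∩p∣≡∣⁅b⁆∩p∣ =
    trans (∣⁅x⁆∩p∣≡lookup a p) (trans (cong (if_then 1 else 0) a~b) (sym (∣⁅x⁆∩p∣≡lookup b p)))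
  2∣k+k : 2 ∣ k + k
  2∣k+k = subst (2 ∣_) (cong (k +_) (+-identityʳ k)) (m∣m*n k)

endpoints-nonempty : (es : EdgeList n) → 1 ≤ length es → Nonempty (endpoints es)
endpoints-nonempty ((a , b) ∷ es) _ = a , x∈p∪q⁺ (inj₁ (x∈⁅x⁆ a))

∪-monoʳ-⊆ : (p : Subset n) {q r : Subset n} → q ⊆ r → p ∪ q ⊆ p ∪ r
∪-monoʳ-⊆ p {q} q⊆r = x∈p∪q⁺ ∘ ⊎-map₂ q⊆r ∘ x∈p∪q⁻ p q

endpoints-mono : {es fs : EdgeList n} → es Sublist.⊆ fs → endpoints es ⊆ endpoints fs
endpoints-mono []                 = id
endpoints-mono ((a , b) ∷ʳ τ)     = q⊆p∪q ⁅ a ⁆ _ ∘ q⊆p∪q ⁅ b ⁆ _ ∘ endpoints-mono τ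
endpoints-mono {es = (a , b) ∷ _} (refl ∷ τ) = ∪-monoʳ-⊆ ⁅ a ⁆ (∪-monoʳ-⊆ ⁅ b ⁆ (endpoints-mono τ))

IsMatching-resp-⊆ : {es fs : EdgeList n} → es Sublist.⊆ fs → IsMatching fs → IsMatching es
IsMatching-resp-⊆ []         _                        = tt
IsMatching-resp-⊆ (_ ∷ʳ τ)   (_ , _ , _ , m)          = IsMatching-resp-⊆ τ m
IsMatching-resp-⊆ (refl ∷ τ) (a≢b , a∉fs , b∉fs , m) =
  a≢b , a∉fs ∘ endpoints-mono τ , b∉fs ∘ endpoints-mono τ , IsMatching-resp-⊆ τ m

Consecutive : Fin n × Fin n → Set
Consecutive (a , b) = toℕ b ≡ suc (toℕ a)

<-consecutiveˡ : {i a b : Fin n} → Consecutive (a , b) → i ≢ a → i Fin.< a ⇔ i Fin.< b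
<-consecutiveˡ ab i≢a = mk⇔
  (λ i<a → <-trans i<a (≤-reflexive (sym ab)))
  (λ i<b → ≤∧≢⇒< (m<1+n⇒m≤n (subst (_ <_) ab i<b)) (i≢a ∘ toℕ-injective))

<-consecutiveʳ : {j a b : Fin n} → Consecutive (a , b) → j ≢ b → a Fin.< j ⇔ b Fin.< j
<-consecutiveʳ ab j≢b = mk⇔
  (λ a<j → ≤∧≢⇒< (subst (_≤ _) (sym ab) a<j) (j≢b ∘ sym ∘ toℕ-injective))
  (λ b<j → <-trans (≤-reflexive (sym ab)) b<j)

⌊⌋-⇔ : {A B : Set} → A ⇔ B → (a? : Dec A) (b? : Dec B) → ⌊ a? ⌋ ≡ ⌊ b? ⌋
⌊⌋-⇔ A⇔B a? b? = trans (isYes≗does a?) (trans (does-⇔ A⇔B a? b?) (sym (isYes≗does b?)))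

between-balanced : (i j : Fin n) {a b : Fin n} → Consecutive (a , b) → i ≢ a → j ≢ b →
                   Balanced (between i j) (a , b)
between-balanced i j {a} {b} ab i≢a j≢b = begin
  lookup (between i j) a              ≡⟨ lookup∘tabulate _ a ⟩
  ⌊ i <? a ⌋ ∧ ⌊ a <? j ⌋             ≡⟨ cong₂ _∧_ (⌊⌋-⇔ (<-consecutiveˡ ab i≢a) (i <? a) (i <? b))
                                                   (⌊⌋-⇔ (<-consecutiveʳ ab j≢b) (a <? j) (b <? j)) ⟩
  ⌊ i <? b ⌋ ∧ ⌊ b <? j ⌋             ≡⟨ lookup∘tabulate _ b ⟨
  lookup (between i j) b              ∎
  where open ≡-Reasoning

∉endpoints⇒∉edges : {x : Fin n} (es : EdgeList n) → x ∉ endpoints es →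
                    All (λ e → x ≢ proj₁ e × x ≢ proj₂ e) es
∉endpoints⇒∉edges []             _     = []
∉endpoints⇒∉edges ((a , b) ∷ es) x∉es =
  ( (λ { refl → x∉es (x∈p∪q⁺ (inj₁ (x∈⁅x⁆ a))) })
  , (λ { refl → x∉es (q⊆p∪q ⁅ a ⁆ _ (x∈p∪q⁺ (inj₁ (x∈⁅x⁆ b)))) }) ) ∷
  ∉endpoints⇒∉edges es (x∉es ∘ q⊆p∪q ⁅ a ⁆ _ ∘ q⊆p∪q ⁅ b ⁆ _)

endpoints-isFCEdge : (es : EdgeList n) → IsMatching es → All Consecutive es →
                     IsFCEdge (2 * length es) n (endpoints es)
endpoints-isFCEdge es m cons = ∣endpoints∣≡2*length es m , even
  where
  even : ∀ i j → i ∉ endpoints es → j ∉ endpoints es → 2 ∣ ∣ endpoints es ∩ between i j ∣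
  even i j i∉es j∉es =
    subst (2 ∣_) (sym (∣endpoints∩p∣≡incidences es m (between i j)))
      (incidences-even (between i j) es
        (All.zipWith (λ { ((ab , (i≢a , _)) , (_ , j≢b)) → between-balanced i j ab i≢a j≢b })
          ((All.zip (cons , ∉endpoints⇒∉edges es i∉es)) , ∉endpoints⇒∉edges es j∉es)))

shift₂ : Fin n × Fin n → Fin (2 + n) × Fin (2 + n)
shift₂ e = suc (suc (proj₁ e)) , suc (suc (proj₂ e))

endpoints-shift₂ : (es : EdgeList n) → endpoints (map shift₂ es) ≡ outside ∷ outside ∷ endpoints es
endpoints-shift₂ []             = refl
endpoints-shift₂ ((a , b) ∷ es) =
  cong (⁅ suc (suc a) ⁆ ∪_) (cong (⁅ suc (suc b) ⁆ ∪_) (endpoints-shift₂ es))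

IsMatching-shift₂ : (es : EdgeList n) → IsMatching es → IsMatching (map shift₂ es)
IsMatching-shift₂ []             _                        = tt
IsMatching-shift₂ ((a , b) ∷ es) (a≢b , a∉es , b∉es , m) rewrite endpoints-shift₂ es =
  (λ { refl → a≢b refl }) ,
  (λ { (there (there a∈)) → a∉es a∈ }) ,
  (λ { (there (there b∈)) → b∉es b∈ }) ,
  IsMatching-shift₂ es m

matching-isMatching : (n : ℕ) → IsMatching (matching n)
matching-isMatching zero          = tt
matching-isMatching (suc zero)    = tt
matching-isMatching (suc (suc n)) rewrite endpoints-shift₂ (matching n) =
  (λ ()) , (λ ()) , (λ { (there ()) }) , IsMatching-shift₂ (matching n) (matching-isMatching n)

matching-consecutive : (n : ℕ) → All Consecutive (matching n)
matching-consecutive zero          = []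
matching-consecutive (suc zero)    = []
matching-consecutive (suc (suc n)) = refl ∷ map⁺ (All.map (cong (2 +_)) (matching-consecutive n))

chosen : (xs : EdgeList n) (φ : Fin n → Fin c) → Subset (length (palette xs φ)) → EdgeList n
chosen []       φ []            = []
chosen (e ∷ xs) φ (inside  ∷ F) = e ∷ chosen xs φ F
chosen (e ∷ xs) φ (outside ∷ F) = chosen xs φ F

module _ (φ : Fin n → Fin c) where

  chosen-⊆ : (xs : EdgeList n) (F : Subset (length (palette xs φ))) → chosen xs φ F Sublist.⊆ xs
  chosen-⊆ []       []            = []
  chosen-⊆ (e ∷ xs) (inside  ∷ F) = refl ∷ chosen-⊆ xs F
  chosen-⊆ (e ∷ xs) (outside ∷ F) = e ∷ʳ chosen-⊆ xs F

  length-chosen : (xs : EdgeList n) (F : Subset (length (palette xs φ))) →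
                  length (chosen xs φ F) ≡ ∣ F ∣
  length-chosen []       []            = refl
  length-chosen (e ∷ xs) (inside  ∷ F) = cong suc (length-chosen xs F)
  length-chosen (e ∷ xs) (outside ∷ F) = length-chosen xs F

  colourClass : Fin c → Subset n
  colourClass v = tabulate (λ x → ⌊ φ x ≟ v ⌋)

  ∣⁅x⁆∩colourClass∣≡⌊φx≟v⌋ : (x : Fin n) (v : Fin c) →
                             ∣ ⁅ x ⁆ ∩ colourClass v ∣ ≡ (if ⌊ φ x ≟ v ⌋ then 1 else 0)
  ∣⁅x⁆∩colourClass∣≡⌊φx≟v⌋ x v =
    trans (∣⁅x⁆∩p∣≡lookup x (colourClass v)) (cong (if_then 1 else 0) (lookup∘tabulate _ x))

  ∈colourClass⇒≡ : {y : Fin n} {v : Fin c} → y ∈ colourClass v → φ y ≡ v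
  ∈colourClass⇒≡ {y} {v} y∈ with φ y ≟ v | trans (sym (lookup∘tabulate _ y)) ([]=⇒lookup y∈)
  ... | yes φy≡v | _ = φy≡v
  ... | no _     | ()

  degree≡incidences : (xs : EdgeList n) (F : Subset (length (palette xs φ))) (v : Fin c) →
                      degree (palette xs φ) F v ≡ incidences (colourClass v) (chosen xs φ F)
  degree≡incidences []             []            v = refl
  degree≡incidences ((a , b) ∷ xs) (outside ∷ F) v = degree≡incidences xs F v
  degree≡incidences ((a , b) ∷ xs) (inside  ∷ F) v = begin
    endCount (φ a , φ b) v + degree (palette xs φ) F v
      ≡⟨ cong₂ _+_ (sym (cong₂ _+_ (∣⁅x⁆∩colourClass∣≡⌊φx≟v⌋ a v)
                                    (∣⁅x⁆∩colourClass∣≡⌊φx≟v⌋ b v)))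
                   (degree≡incidences xs F v) ⟩
    (∣ ⁅ a ⁆ ∩ colourClass v ∣ + ∣ ⁅ b ⁆ ∩ colourClass v ∣)
      + incidences (colourClass v) (chosen xs φ F)
      ≡⟨ +-assoc ∣ ⁅ a ⁆ ∩ colourClass v ∣ _ _ ⟩
    incidences (colourClass v) (chosen ((a , b) ∷ xs) φ (inside ∷ F)) ∎
    where open ≡-Reasoning

  degree≡∣endpoints∩colourClass∣ : (xs : EdgeList n) (F : Subset (length (palette xs φ))) →
    IsMatching (chosen xs φ F) → (v : Fin c) →
    degree (palette xs φ) F v ≡ ∣ endpoints (chosen xs φ F) ∩ colourClass v ∣
  degree≡∣endpoints∩colourClass∣ xs F m v =
    trans (degree≡incidences xs F v)
          (sym (∣endpoints∩p∣≡incidences (chosen xs φ F) m (colourClass v)))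

  chosen-colours∈ : (xs : EdgeList n) (F : Subset (length (palette xs φ))) {W : Subset c} →
                    IsSubMultigraph (palette xs φ) W F →
                    ∀ {x} → x ∈ endpoints (chosen xs φ F) → φ x ∈ W
  chosen-colours∈ []             []            sub x∈ = ⊥-elim (∉⊥ x∈)
  chosen-colours∈ ((a , b) ∷ xs) (outside ∷ F) sub x∈ =
    chosen-colours∈ xs F (λ i i∈F → sub (suc i) (there i∈F)) x∈
  chosen-colours∈ ((a , b) ∷ xs) (inside  ∷ F) sub x∈ with x∈p∪q⁻ ⁅ a ⁆ _ x∈
  ... | inj₁ x∈a rewrite x∈⁅y⁆⇒x≡y a x∈a = proj₁ (sub zero here)
  ... | inj₂ x∈b∪es with x∈p∪q⁻ ⁅ b ⁆ _ x∈b∪es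
  ...   | inj₁ x∈b rewrite x∈⁅y⁆⇒x≡y b x∈b = proj₂ (sub zero here)
  ...   | inj₂ x∈es = chosen-colours∈ xs F (λ i i∈F → sub (suc i) (there i∈F)) x∈es

  uniqueColour⇒∣∩colourClass∣≤1 : {S : Subset n} {x : Fin n} → x ∈ S →
    (∀ y → y ∈ S → y ≢ x → φ y ≢ φ x) → ∣ S ∩ colourClass (φ x) ∣ ≤ 1
  uniqueColour⇒∣∩colourClass∣≤1 {S} {x} x∈S unique =
    ≤-trans (p⊆q⇒∣p∣≤∣q∣ ⊆⁅x⁆) (≤-reflexive (∣⁅x⁆∣≡1 x))
    where
    ⊆⁅x⁆ : S ∩ colourClass (φ x) ⊆ ⁅ x ⁆
    ⊆⁅x⁆ {y} y∈ with x∈p∩q⁻ S _ y∈ | y Fin.≟ x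
    ... | _   , _       | yes refl = x∈⁅x⁆ x
    ... | y∈S , y∈class | no y≢x   = contradiction (∈colourClass⇒≡ y∈class) (unique y y∈S y≢x)

lemma2p4 : (l n c : ℕ) → 2 ≤ l → 2 * l + 1 ≤ n →
    (φ : Fin n → Fin c) → IsCFColoring (FC (2 * l) n) φ →
    ¬ HasSubMultigraphMinDeg2 (palette (matching n) φ) l
lemma2p4 l n c 2≤l _ φ cf (W , F , sub , ∣F∣≡l , deg≥2) =
  let x , x∈S , unique = cf S S-isFCEdge S-nonempty
  in ≤⇒≯ (uniqueColour⇒∣∩colourClass∣≤1 φ x∈S unique) (colour-repeated x∈S)
  where
  es : EdgeList n
  es = chosen (matching n) φ F

  es⊆matching : es Sublist.⊆ matching n
  es⊆matching = chosen-⊆ φ (matching n) F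

  es-isMatching : IsMatching es
  es-isMatching = IsMatching-resp-⊆ es⊆matching (matching-isMatching n)

  length-es≡l : length es ≡ l
  length-es≡l = trans (length-chosen φ (matching n) F) ∣F∣≡l

  S : Subset n
  S = endpoints es

  S-isFCEdge : IsFCEdge (2 * l) n S
  S-isFCEdge = subst (λ k → IsFCEdge (2 * k) n S) length-es≡l
    (endpoints-isFCEdge es es-isMatching (All-resp-⊆ es⊆matching (matching-consecutive n)))

  S-nonempty : Nonempty S
  S-nonempty = endpoints-nonempty es (subst (1 ≤_) (sym length-es≡l) (≤-trans (s≤s z≤n) 2≤l))

  colour-repeated : ∀ {x} → x ∈ S → 2 ≤ ∣ S ∩ colourClass φ (φ x) ∣
  colour-repeated {x} x∈S =
    subst (2 ≤_) (degree≡∣endpoints∩colourClass∣ φ (matching n) F es-isMatching (φ x))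
          (deg≥2 (φ x) (chosen-colours∈ φ (matching n) F sub x∈S))
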